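{- Every graph with no isolated vertex has a total dominating sequence of even length.
   Context: All graphs are finite and simple. $N(v)$ is the set of neighbors of $v$. For a graph $G$ with no isolated vertices, a set $A\subseteq V(G)$ is a total dominating set if every vertex of $G$ has a neighbor in $A$. A sequence $(v_1,\dots,v_m)$ of distinct vertices is legal if $N(v_i)\setminus\bigcup_{j=1}^{i-1}N(v_j)\neq\emptyset$ for every $i\in\{2,\dots,m\}$; it is a total dominating sequence if moreover $\{v_1,\dots,v_m\}$ is a total dominating set. -}

module Defs where

open import Data.Nat using (ℕ; _*_)
open import Data.Fin using (Fin)
open import Data.List using (List; []; _∷_; length)
open import Data.List.Membership.Propositional using (_∈_)
open import Data.List.Relation.Unary.All using (All)
open import Data.List.Relation.Unary.Any using (Any)
open import Data.List.Relation.Unary.Unique.Propositional using (Unique)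
open import Data.Product using (Σ; ∃; _×_)
open import Relation.Nullary using (¬_; Dec)
open import Relation.Binary.PropositionalEquality using (_≡_)
open import Data.Unit using (⊤)

record Graph (n : ℕ) : Set₁ where
  field
    Adj   : Fin n → Fin n → Set
    adj?  : ∀ u v → Dec (Adj u v)
    sym   : ∀ {u v} → Adj u v → Adj v u
    irrefl : ∀ {u} → ¬ Adj u u

module _ {n : ℕ} (G : Graph n) where
  open Graph G

  NoIsolated : Set
  NoIsolated = ∀ v → ∃ λ u → Adj v u

  PrivateNbr : List (Fin n) → Fin n → Fin n → Set
  PrivateNbr prev v w = Adj v w × All (λ u → ¬ Adj u w) prev

  LegalFrom : List (Fin n) → List (Fin n) → Set
  LegalFrom prev [] = ⊤
  LegalFrom prev (v ∷ rest) = (∃ λ w → PrivateNbr prev v w) × LegalFrom (v ∷ prev) rest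

  Legal : List (Fin n) → Set
  Legal [] = ⊤
  Legal (v ∷ rest) = LegalFrom (v ∷ []) rest

  IsTotalDominating : List (Fin n) → Set
  IsTotalDominating A = ∀ v → Any (λ a → Adj v a) A

  IsTDS : List (Fin n) → Set
  IsTDS s = Unique s × Legal s × IsTotalDominating s

-- Start from any total dominating set S without repetitions (all vertices, say). If some x ∈ S has
-- no S-private neighbour (a neighbour w whose only neighbour in S is x), drop x. Otherwise S is
-- open irredundant, so S in any order is a legal sequence, and we are done if |S| is even.
-- If |S| is odd, "y is an S-private neighbour of x" restricted to S cannot be a perfect
-- matching of S, so some v ∈ S has no S-private neighbour inside S; pick one, q, outside S.
-- Let A be the vertices of S all of whose S-private neighbours are adjacent to q, and C the
-- rest. If v has no neighbour in A, then A, q, C is a total dominating sequence of length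
-- |S| + 1. Otherwise exchanging a neighbour a ∈ A of v for q keeps S total dominating and of
-- the same size, but strictly decreases the number of unpaired vertices (those with no
-- S-private neighbour inside S): v becomes paired, and q is unpaired only if a was. Hence the
-- process terminates, by induction on (|S|, number of unpaired vertices) lexicographically.
module Submission where

open import Defs
open import Data.Nat using (ℕ; zero; suc; _+_; _*_; _<_; s≤s; z≤n)
open import Data.Nat.Properties using (+-suc; +-comm; *-suc; even≢odd; ≤-trans; module ≤-Reasoning)
open import Data.Nat.Induction using (<-wellFounded)
open import Data.Fin using (Fin)
open import Data.Fin.Properties using (_≟_; any?)
open import Data.Fin.Permutation.Components using (transpose; transpose-inverse)
open import Data.List using (List; []; _∷_; _++_; _ʳ++_; length; filter; map; allFin)
open import Data.List.Properties
  using (length-++; length-map; length-filter; filter-notAll; filter-accept; filter-reject; filter-all)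
open import Data.List.Membership.Propositional using (_∈_; _∉_; lose; find)
open import Data.List.Membership.Propositional.Properties
  using (∈-filter⁺; ∈-filter⁻; ∈-++⁺ˡ; ∈-++⁺ʳ; ∈-map⁻; ∈-allFin)
open import Data.List.Relation.Binary.Subset.Propositional using (_⊆_)
open import Data.List.Relation.Binary.Subset.Propositional.Properties using (∷⁺ʳ; Any-resp-⊆)
open import Data.List.Relation.Unary.All as All using (All; []; _∷_)
open import Data.List.Relation.Unary.All.Properties using (anti-mono; ¬All⇒Any¬; ¬Any⇒All¬)
open import Data.List.Relation.Unary.Any as Any using (Any; here; there)
open import Data.List.Relation.Unary.Any.Properties using (reverse⁻; ++⁺ˡ; ++⁺ʳ)
open import Data.List.Relation.Unary.AllPairs using ([]; _∷_)
open import Data.List.Relation.Unary.Unique.Propositional using (Unique)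
open import Data.List.Relation.Unary.Unique.Propositional.Properties using (filter⁺; ++⁺; map⁺; allFin⁺)
open import Data.Product using (Σ; ∃; _×_; _,_; proj₁; proj₂; map₂)
open import Data.Product.Relation.Binary.Lex.Strict using (×-Lex; ×-wellFounded)
open import Data.Sum using (_⊎_; inj₁; inj₂; [_,_]′)
open import Data.Unit using (tt)
open import Data.Empty using (⊥-elim)
open import Function using (_∘_; _on_)
open import Induction.WellFounded as WF using (WellFounded)
open import Relation.Binary.Construct.On as On using ()
open import Relation.Binary.Definitions using (DecidableEquality)
open import Relation.Nullary using (¬_; Dec; yes; no; ¬?)
open import Relation.Nullary.Decidable using (_×-dec_; _→-dec_; decidable-stable; dec-true; dec-false)
open import Relation.Unary using (Pred; Decidable)
open import Relation.Unary.Properties using (∁?)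
open import Relation.Binary.PropositionalEquality
  using (_≡_; _≢_; refl; sym; trans; cong; subst; module ≡-Reasoning)

Even : ℕ → Set
Even m = ∃ λ k → m ≡ 2 * k

even-suc-suc : ∀ {m} → Even m → Even (suc (suc m))
even-suc-suc (k , m≡2k) = suc k , trans (cong (2 +_) m≡2k) (sym (*-suc 2 k))

even⊎even-suc : ∀ m → Even m ⊎ Even (suc m)
even⊎even-suc zero    = inj₁ (0 , refl)
even⊎even-suc (suc m) = [ inj₂ ∘ even-suc-suc , inj₁ ]′ (even⊎even-suc m)

even⇒¬even-suc : ∀ {m} → Even m → ¬ Even (suc m)
even⇒¬even-suc (j , m≡2j) (k , 1+m≡2k) = even≢odd k j (trans (sym 1+m≡2k) (cong suc m≡2j))

length-filter+length-filter-∁ : ∀ {a p} {A : Set a} {P : Pred A p} (P? : Decidable P) xs →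
  length (filter P? xs) + length (filter (∁? P?) xs) ≡ length xs
length-filter+length-filter-∁ P? [] = refl
length-filter+length-filter-∁ P? (x ∷ xs) with P? x
... | yes _ = cong suc (length-filter+length-filter-∁ P? xs)
... | no  _ = trans (+-suc _ _) (cong suc (length-filter+length-filter-∁ P? xs))

module Removal {a} {A : Set a} (_≟_ : DecidableEquality A) where

  private variable
    x y : A
    xs ys : List A

  remove : A → List A → List A
  remove y = filter (λ x → ¬? (x ≟ y))

  ∈-remove⁺ : x ∈ xs → x ≢ y → x ∈ remove y xs
  ∈-remove⁺ = ∈-filter⁺ (λ x → ¬? (x ≟ _))

  ∈-remove⁻ : ∀ xs → x ∈ remove y xs → x ∈ xs × x ≢ y
  ∈-remove⁻ xs = ∈-filter⁻ (λ x → ¬? (x ≟ _)) {xs = xs}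

  remove-⊆ : ∀ xs → remove y xs ⊆ xs
  remove-⊆ xs = proj₁ ∘ ∈-remove⁻ xs

  remove-unique : Unique xs → Unique (remove y xs)
  remove-unique = filter⁺ (λ x → ¬? (x ≟ _))

  length-remove-< : y ∈ xs → length (remove y xs) < length xs
  length-remove-< y∈xs = filter-notAll (λ x → ¬? (x ≟ _)) _ (Any.map (λ x≡y x≢y → x≢y (sym x≡y)) y∈xs)

  length-remove : Unique xs → y ∈ xs → suc (length (remove y xs)) ≡ length xs
  length-remove {x ∷ xs} (x∉xs ∷ _) (here refl) = cong suc (begin
    length (remove x (x ∷ xs))  ≡⟨ cong length (filter-reject (λ z → ¬? (z ≟ x)) (λ x≢x → x≢x refl)) ⟩
    length (remove x xs)        ≡⟨ cong length (filter-all (λ z → ¬? (z ≟ x)) (All.map (_∘ sym) x∉xs)) ⟩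
    length xs                   ∎)
    where open ≡-Reasoning
  length-remove {x ∷ xs} {y} (x∉xs ∷ xs-unique) (there y∈xs)
    rewrite filter-accept (λ z → ¬? (z ≟ y)) {x} {xs} (All.lookup x∉xs y∈xs)
    = cong suc (length-remove xs-unique y∈xs)

  length-<-⊆ : Unique xs → xs ⊆ ys → y ∈ ys → y ∉ xs → length xs < length ys
  length-<-⊆ {[]} _ _ (here _)  _ = s≤s z≤n
  length-<-⊆ {[]} _ _ (there _) _ = s≤s z≤n
  length-<-⊆ {x ∷ xs} {ys} {y} (x∉xs ∷ xs-unique) x∷xs⊆ys y∈ys y∉x∷xs =
    ≤-trans (s≤s xs<ys-x) (length-remove-< (x∷xs⊆ys (here refl)))
    where
    xs<ys-x : length xs < length (remove x ys)
    xs<ys-x = length-<-⊆ xs-unique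
      (λ z∈xs → ∈-remove⁺ (x∷xs⊆ys (there z∈xs)) (λ z≡x → All.lookup x∉xs z∈xs (sym z≡x)))
      (∈-remove⁺ y∈ys (y∉x∷xs ∘ here))
      (y∉x∷xs ∘ there)

  module _ {r} (R : A → A → Set r)
           (R-sym : ∀ {x y} → R x y → R y x)
           (R-functional : ∀ {x y z} → R x y → R x z → y ≡ z)
           (R-irrefl : ∀ {x} → ¬ R x x) where

    PerfectlyMatched : List A → Set _
    PerfectlyMatched xs = ∀ {x} → x ∈ xs → ∃ λ y → y ∈ xs × R x y

    perfectlyMatched⇒even : ∀ xs → Unique xs → PerfectlyMatched xs → Even (length xs)
    perfectlyMatched⇒even = WF.All.wfRec (On.wellFounded length <-wellFounded) _ Motive step
      where
      Motive : List A → Set _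
      Motive xs = Unique xs → PerfectlyMatched xs → Even (length xs)

      step : ∀ xs → (∀ {ys} → length ys < length xs → Motive ys) → Motive xs
      step []       _  _                    _       = 0 , refl
      step (x ∷ xs) ih (x∉xs ∷ xs-unique) matched with matched (here refl)
      ... | _ , here refl  , Rxx = ⊥-elim (R-irrefl Rxx)
      ... | y , there y∈xs , Rxy =
        subst (Even ∘ suc) (length-remove xs-unique y∈xs)
          (even-suc-suc (ih (s≤s (length-filter _ xs))
            (remove-unique xs-unique) matched-rest))
        where
        matched-rest : PerfectlyMatched (remove y xs)
        matched-rest {z} z∈rest with ∈-remove⁻ xs z∈rest
        ... | z∈xs , z≢y with matched (there z∈xs)
        ...   | _ , here refl  , Rzx = ⊥-elim (z≢y (sym (R-functional Rxy (R-sym Rzx))))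
        ...   | w , there w∈xs , Rzw = w , ∈-remove⁺ w∈xs w≢y , Rzw
          where
          w≢y : w ≢ y
          w≢y refl = All.lookup x∉xs z∈xs (R-functional (R-sym Rxy) (R-sym Rzw))

module _ {n : ℕ} (G : Graph n) where
  open Graph G renaming (sym to adj-sym)
  open Removal (_≟_ {n})

  private
    V : Set
    V = Fin n

    variable
      S S′ prev prev′ L L′ : List V
      a u v w x : V

  PrivateFor : List V → V → V → Set
  PrivateFor S x w = Adj x w × All (λ u → u ≢ x → ¬ Adj u w) S

  privateFor? : ∀ S x w → Dec (PrivateFor S x w)
  privateFor? S x w = adj? x w ×-dec All.all? (λ u → ¬? (u ≟ x) →-dec ¬? (adj? u w)) S

  privateFor-excludes : PrivateFor S x w → u ∈ S → u ≢ x → ¬ Adj u w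
  privateFor-excludes (_ , excluded) = All.lookup excluded

  privateFor⇒sole-neighbour : PrivateFor S x w → u ∈ S → Adj u w → u ≡ x
  privateFor⇒sole-neighbour {x = x} {u = u} x-w u∈S uw =
    decidable-stable (u ≟ x) (λ u≢x → privateFor-excludes x-w u∈S u≢x uw)

  privateFor-⊆ : S′ ⊆ S → PrivateFor S x w → PrivateFor S′ x w
  privateFor-⊆ S′⊆S = map₂ (anti-mono S′⊆S)

  privateFor-∷ : (u ≢ x → ¬ Adj u w) → PrivateFor S x w → PrivateFor (u ∷ S) x w
  privateFor-∷ excluded (xw , excludedˢ) = xw , excluded ∷ excludedˢ

  OpenIrredundant : List V → Set
  OpenIrredundant S = All (λ x → ∃ (PrivateFor S x)) S

  openIrredundant? : ∀ S → Dec (OpenIrredundant S)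
  openIrredundant? S = All.all? (λ x → any? (privateFor? S x)) S

  Paired : List V → V → Set
  Paired S x = Any (PrivateFor S x) S

  paired? : ∀ S x → Dec (Paired S x)
  paired? S x = Any.any? (privateFor? S x) S

  unpairedIn : List V → List V
  unpairedIn S = filter (∁? (paired? S)) S

  unpaired : List V → ℕ
  unpaired S = length (unpairedIn S)

  _≺_ : List V → List V → Set
  _≺_ = ×-Lex _≡_ _<_ _<_ on (λ S → length S , unpaired S)

  ≺-wellFounded : WellFounded _≺_
  ≺-wellFounded = On.wellFounded _ (×-wellFounded <-wellFounded <-wellFounded)

  legalFrom-antitone : prev ⊆ prev′ → LegalFrom G prev′ L → LegalFrom G prev L
  legalFrom-antitone {L = []}    _       _ = tt
  legalFrom-antitone {L = x ∷ L} prev⊆prev′ ((w , xw , fresh) , rest) =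
    (w , xw , anti-mono prev⊆prev′ fresh) , legalFrom-antitone (∷⁺ʳ x prev⊆prev′) rest

  legalFrom-++ : ∀ L → LegalFrom G prev L → LegalFrom G (L ʳ++ prev) L′ → LegalFrom G prev (L ++ L′)
  legalFrom-++ []      _               legal-L′ = legal-L′
  legalFrom-++ (x ∷ L) (first , rest) legal-L′ = first , legalFrom-++ L rest legal-L′

  privateWitnesses⇒legalFrom : Unique L →
    All (λ x → ∃ λ w → PrivateFor L x w × All (λ u → ¬ Adj u w) prev) L → LegalFrom G prev L
  privateWitnesses⇒legalFrom [] [] = tt
  privateWitnesses⇒legalFrom {x ∷ L} {prev} (x∉L ∷ L-unique) ((w , (xw , _) , fresh) ∷ witnesses) =
    (w , xw , fresh) , privateWitnesses⇒legalFrom L-unique (All.zipWith shift (x∉L , witnesses))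
    where
    shift : ∀ {y} → x ≢ y × (∃ λ w → PrivateFor (x ∷ L) y w × All (λ u → ¬ Adj u w) prev) →
            ∃ λ w → PrivateFor L y w × All (λ u → ¬ Adj u w) (x ∷ prev)
    shift (x≢y , (w′ , (yw′ , x-excluded ∷ excluded) , fresh′)) =
      w′ , (yw′ , excluded) , x-excluded x≢y ∷ fresh′

  legalFrom[]⇒legal : LegalFrom G [] L → Legal G L
  legalFrom[]⇒legal {[]}    _          = tt
  legalFrom[]⇒legal {_ ∷ _} (_ , rest) = rest

  openIrredundant⇒legal : Unique S → OpenIrredundant S → Legal G S
  openIrredundant⇒legal S-unique irredundant =
    legalFrom[]⇒legal (privateWitnesses⇒legalFrom S-unique (All.map (λ (w , x-w) → w , x-w , []) irredundant))

  totalDominating-exchange : ∀ T → IsTotalDominating G S →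
    (∀ {w} → PrivateFor S a w → Any (Adj w) T) → IsTotalDominating G (T ++ remove a S)
  totalDominating-exchange {S} {a} T S-dominating covered x with find (S-dominating x)
  ... | s , s∈S , xs with s ≟ a
  ...   | no s≢a = ++⁺ʳ T (lose (∈-remove⁺ s∈S s≢a) xs)
  ...   | yes refl with Any.any? (adj? x) (remove a S)
  ...     | yes dominated = ++⁺ʳ T dominated
  ...     | no ¬dominated = ++⁺ˡ (covered (adj-sym xs , All.tabulate λ u∈S u≢a ux →
                                   ¬dominated (lose (∈-remove⁺ u∈S u≢a) (adj-sym ux))))

  allPaired⇒even : Unique S → All (Paired S) S → Even (length S)
  allPaired⇒even {S} S-unique all-paired =
    perfectlyMatched⇒even Partner partner-sym partner-functional (irrefl ∘ proj₁ ∘ proj₂ ∘ proj₂)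
      S S-unique partner
    where
    Partner : V → V → Set
    Partner x y = x ∈ S × y ∈ S × PrivateFor S x y

    partner : ∀ {x} → x ∈ S → ∃ λ y → y ∈ S × Partner x y
    partner x∈S with find (All.lookup all-paired x∈S)
    ... | y , y∈S , x-y = y , y∈S , x∈S , y∈S , x-y

    partner-sym : ∀ {x y} → Partner x y → Partner y x
    partner-sym (x∈S , y∈S , x-y) with find (All.lookup all-paired y∈S)
    ... | z , z∈S , y-z with privateFor⇒sole-neighbour x-y z∈S (adj-sym (proj₁ y-z))
    ...   | refl = y∈S , x∈S , y-z

    partner-functional : ∀ {x y z} → Partner x y → Partner x z → y ≡ z
    partner-functional x-y (_ , z∈S , x-z) =
      sym (privateFor⇒sole-neighbour (proj₂ (proj₂ (partner-sym x-y))) z∈S (adj-sym (proj₁ x-z)))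

  module OddCase (S-unique : Unique S) (S-irredundant : OpenIrredundant S)
                 (v∈S : v ∈ S) (v-unpaired : ¬ Paired S v) where

    q : V
    q = proj₁ (All.lookup S-irredundant v∈S)

    v-q : PrivateFor S v q
    v-q = proj₂ (All.lookup S-irredundant v∈S)

    q∉S : q ∉ S
    q∉S q∈S = v-unpaired (lose q∈S v-q)

    q-neighbour : w ∈ S → Adj q w → w ≡ v
    q-neighbour w∈S qw = privateFor⇒sole-neighbour v-q w∈S (adj-sym qw)

    Uncovered : V → Set
    Uncovered x = ∃ λ w → PrivateFor S x w × ¬ Adj q w

    uncovered? : ∀ x → Dec (Uncovered x)
    uncovered? x = any? (λ w → privateFor? S x w ×-dec ¬? (adj? q w))

    A C : List V
    A = filter (∁? uncovered?) S
    C = filter uncovered? S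

    A⊆S : A ⊆ S
    A⊆S = proj₁ ∘ ∈-filter⁻ (∁? uncovered?) {xs = S}

    C⊆S : C ⊆ S
    C⊆S = proj₁ ∘ ∈-filter⁻ uncovered? {xs = S}

    C-uncovered : x ∈ C → Uncovered x
    C-uncovered = proj₂ ∘ ∈-filter⁻ uncovered? {xs = S}

    A-covered : x ∈ A → PrivateFor S x w → Adj q w
    A-covered {w = w} x∈A x-w = decidable-stable (adj? q w) λ ¬qw →
      proj₂ (∈-filter⁻ (∁? uncovered?) {xs = S} x∈A) (w , x-w , ¬qw)

    A∩C-empty : x ∈ A → x ∉ C
    A∩C-empty x∈A x∈C = proj₂ (∈-filter⁻ (∁? uncovered?) {xs = S} x∈A) (C-uncovered x∈C)

    module Extension (v∉N[A] : All (λ a → ¬ Adj a v) A) where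

      sequence : List V
      sequence = A ++ q ∷ C

      sequence-unique : Unique sequence
      sequence-unique = ++⁺ (filter⁺ _ S-unique) (q∉C ∷ filter⁺ _ S-unique) disjoint
        where
        q∉C : All (q ≢_) C
        q∉C = All.tabulate λ { z∈C refl → q∉S (C⊆S z∈C) }
        disjoint : ∀ {z} → ¬ (z ∈ A × z ∈ q ∷ C)
        disjoint (z∈A , here refl)  = q∉S (A⊆S z∈A)
        disjoint (z∈A , there z∈C) = A∩C-empty z∈A z∈C

      A-legal : LegalFrom G [] A
      A-legal = privateWitnesses⇒legalFrom (filter⁺ _ S-unique) (All.tabulate λ x∈A →
        let w , x-w = All.lookup S-irredundant (A⊆S x∈A) in w , privateFor-⊆ A⊆S x-w , [])

      qC-legal : LegalFrom G A (q ∷ C)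
      qC-legal =
        (v , adj-sym (proj₁ v-q) , v∉N[A]) ,
        privateWitnesses⇒legalFrom (filter⁺ _ S-unique) (All.tabulate λ x∈C →
          let w , x-w , ¬qw = C-uncovered x∈C
          in w , privateFor-⊆ C⊆S x-w ,
             ¬qw ∷ All.tabulate (λ u∈A → privateFor-excludes x-w (A⊆S u∈A) λ { refl → A∩C-empty u∈A x∈C }))

      sequence-legal : Legal G sequence
      sequence-legal = legalFrom[]⇒legal (legalFrom-++ A A-legal (legalFrom-antitone reverse⁻ qC-legal))

      S⊆sequence : S ⊆ sequence
      S⊆sequence {x} x∈S with uncovered? x
      ... | yes x-unc = ∈-++⁺ʳ A (there (∈-filter⁺ uncovered? x∈S x-unc))
      ... | no  x-cov = ∈-++⁺ˡ (∈-filter⁺ (∁? uncovered?) x∈S x-cov)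

      length-sequence : length sequence ≡ suc (length S)
      length-sequence = begin
        length (A ++ q ∷ C)        ≡⟨ length-++ A ⟩
        length A + suc (length C)  ≡⟨ +-suc (length A) (length C) ⟩
        suc (length A + length C)  ≡⟨ cong suc (+-comm (length A) (length C)) ⟩
        suc (length C + length A)  ≡⟨ cong suc (length-filter+length-filter-∁ uncovered? S) ⟩
        suc (length S)             ∎
        where open ≡-Reasoning

    module Exchange {a} (a∈A : a ∈ A) (av : Adj a v) where

      a∈S : a ∈ S
      a∈S = A⊆S a∈A

      a≢v : a ≢ v
      a≢v refl = irrefl av

      T : List V
      T = q ∷ remove a S

      T-unique : Unique T
      T-unique = All.tabulate (λ { z∈ refl → q∉S (remove-⊆ S z∈) }) ∷ remove-unique S-unique

      T-dominating : IsTotalDominating G S → IsTotalDominating G T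
      T-dominating S-dominating =
        totalDominating-exchange (q ∷ []) S-dominating (λ a-w → here (adj-sym (A-covered a∈A a-w)))

      length-T : length T ≡ length S
      length-T = length-remove S-unique a∈S

      not-private-of-a : ¬ PrivateFor S x a
      not-private-of-a x-a with privateFor⇒sole-neighbour x-a v∈S (adj-sym av)
      ... | refl = v-unpaired (lose a∈S x-a)

      q-misses-private : x ∈ remove a S → w ∈ S → PrivateFor S x w → ¬ Adj q w
      q-misses-private x∈rest w∈S x-w qw with q-neighbour w∈S qw
      ... | refl = proj₂ (∈-remove⁻ S x∈rest) (sym (privateFor⇒sole-neighbour x-w a∈S av))

      v-paired : Paired T v
      v-paired = here (privateFor-∷ (λ _ → irrefl) (privateFor-⊆ (remove-⊆ S) v-q))

      a-unpaired : ¬ Paired T q → ¬ Paired S a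
      a-unpaired q-unpaired a-paired with find a-paired
      ... | w , w∈S , a-w with q-neighbour w∈S (A-covered a∈A a-w)
      ...   | refl = q-unpaired (there (lose (∈-remove⁺ v∈S (a≢v ∘ sym)) q-v))
        where
        q-v : PrivateFor T q v
        q-v = privateFor-∷ (λ q≢q → ⊥-elim (q≢q refl))
                (adj-sym (proj₁ v-q) , All.tabulate λ u∈rest _ →
                  privateFor-excludes a-w (remove-⊆ S u∈rest) (proj₂ (∈-remove⁻ S u∈rest)))

      rest-unpaired : x ∈ remove a S → ¬ Paired T x → ¬ Paired S x
      rest-unpaired {x} x∈rest x-unpaired x-paired with find x-paired
      ... | w , w∈S , x-w = x-unpaired (there (lose (∈-remove⁺ w∈S w≢a) x-w-in-T))
        where
        w≢a : w ≢ a
        w≢a w≡a = not-private-of-a (subst (PrivateFor S x) w≡a x-w)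
        x-w-in-T : PrivateFor T x w
        x-w-in-T = privateFor-∷ (λ _ → q-misses-private x∈rest w∈S x-w) (privateFor-⊆ (remove-⊆ S) x-w)

      -- q is the only vertex of T outside S, and a the only vertex of S outside T.
      τ : V → V
      τ = transpose q a

      τ-injective : τ u ≡ τ w → u ≡ w
      τ-injective {u} {w} τu≡τw = begin
        u                     ≡⟨ sym (transpose-inverse a q) ⟩
        transpose a q (τ u)   ≡⟨ cong (transpose a q) τu≡τw ⟩
        transpose a q (τ w)   ≡⟨ transpose-inverse a q ⟩
        w                     ∎
        where open ≡-Reasoning

      τ-q : τ q ≡ a
      τ-q rewrite dec-true (q ≟ q) refl = refl

      τ-fixes : u ≢ q → u ≢ a → τ u ≡ u
      τ-fixes {u} u≢q u≢a rewrite dec-false (u ≟ q) u≢q | dec-false (u ≟ a) u≢a = refl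

      τ-unpaired : x ∈ unpairedIn T → τ x ∈ unpairedIn S
      τ-unpaired x∈ with ∈-filter⁻ (∁? (paired? T)) {xs = T} x∈
      ... | here refl , q-unpaired =
        subst (_∈ unpairedIn S) (sym τ-q) (∈-filter⁺ (∁? (paired? S)) a∈S (a-unpaired q-unpaired))
      ... | there x∈rest , x-unpaired =
        let x∈S , x≢a = ∈-remove⁻ S x∈rest
        in subst (_∈ unpairedIn S) (sym (τ-fixes (λ { refl → q∉S x∈S }) x≢a))
             (∈-filter⁺ (∁? (paired? S)) x∈S (rest-unpaired x∈rest x-unpaired))

      v∉τ[unpairedIn-T] : v ∉ map τ (unpairedIn T)
      v∉τ[unpairedIn-T] v∈ with ∈-map⁻ τ v∈
      ... | x , x∈ , v≡τx with ∈-filter⁻ (∁? (paired? T)) {xs = T} x∈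
      ...   | here refl , _ = a≢v (trans (sym τ-q) (sym v≡τx))
      ...   | there x∈rest , x-unpaired =
        let x∈S , x≢a = ∈-remove⁻ S x∈rest
        in x-unpaired (subst (Paired T) (trans v≡τx (τ-fixes (λ { refl → q∉S x∈S }) x≢a)) v-paired)

      fewer-unpaired : unpaired T < unpaired S
      fewer-unpaired = begin-strict
        unpaired T                     ≡⟨ sym (length-map τ (unpairedIn T)) ⟩
        length (map τ (unpairedIn T))  <⟨ length-<-⊆ (map⁺ τ-injective (filter⁺ (∁? (paired? T)) T-unique))
                                            τ[unpairedIn-T]⊆ v∈unpairedIn-S v∉τ[unpairedIn-T] ⟩
        unpaired S                     ∎
        where
        open ≤-Reasoning
        τ[unpairedIn-T]⊆ : map τ (unpairedIn T) ⊆ unpairedIn S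
        τ[unpairedIn-T]⊆ y∈ with ∈-map⁻ τ y∈
        ... | x , x∈ , refl = τ-unpaired x∈
        v∈unpairedIn-S : v ∈ unpairedIn S
        v∈unpairedIn-S = ∈-filter⁺ (∁? (paired? S)) v∈S v-unpaired

    extend-or-exchange : IsTotalDominating G S →
      (Σ (List V) λ s → IsTDS G s × length s ≡ suc (length S)) ⊎
      (Σ (List V) λ T → T ≺ S × Unique T × IsTotalDominating G T)
    extend-or-exchange S-dominating with Any.any? (λ a → adj? a v) A
    ... | no v∉N[A] =
      inj₁ (sequence , (sequence-unique , sequence-legal , Any-resp-⊆ S⊆sequence ∘ S-dominating) ,
            length-sequence)
      where open Extension (¬Any⇒All¬ A v∉N[A])
    ... | yes v∈N[A] with find v∈N[A]
    ...   | a , a∈A , av =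
      inj₂ (T , inj₂ (length-T , fewer-unpaired) , T-unique , T-dominating S-dominating)
      where open Exchange a∈A av

  EvenTDS : Set
  EvenTDS = Σ (List V) λ s → IsTDS G s × Even (length s)

  evenTDS : ∀ S → Unique S → IsTotalDominating G S → EvenTDS
  evenTDS = WF.All.wfRec ≺-wellFounded _ _ step
    where
    step : ∀ S → (∀ {T} → T ≺ S → Unique T → IsTotalDominating G T → EvenTDS) →
           Unique S → IsTotalDominating G S → EvenTDS
    step S ih S-unique S-dominating with openIrredundant? S
    ... | no ¬irredundant with find (¬All⇒Any¬ (λ x → any? (privateFor? S x)) S ¬irredundant)
    ...   | v , v∈S , no-private =
      ih (inj₁ (length-remove-< v∈S)) (remove-unique S-unique)
         (totalDominating-exchange [] S-dominating (λ v-w → ⊥-elim (no-private (_ , v-w))))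
    step S ih S-unique S-dominating | yes irredundant with even⊎even-suc (length S)
    ... | inj₁ even = S , (S-unique , openIrredundant⇒legal S-unique irredundant , S-dominating) , even
    ... | inj₂ odd with All.all? (paired? S) S
    ...   | yes all-paired = ⊥-elim (even⇒¬even-suc (allPaired⇒even S-unique all-paired) odd)
    ...   | no ¬all-paired with find (¬All⇒Any¬ (paired? S) S ¬all-paired)
    ...     | v , v∈S , v-unpaired =
      [ (λ (s , tds , length-s) → s , tds , subst Even (sym length-s) odd)
      , (λ (T , T≺S , T-unique , T-dominating) → ih T≺S T-unique T-dominating)
      ]′ (OddCase.extend-or-exchange S-unique irredundant v∈S v-unpaired S-dominating)

corollary2p4 : (n : ℕ) (G : Graph n) → NoIsolated G →
    Σ (List (Fin n)) λ s → IsTDS G s × ∃ λ k → length s ≡ 2 * k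
corollary2p4 n G no-isolated =
  evenTDS G (allFin n) (allFin⁺ n) (λ x → lose (∈-allFin _) (proj₂ (no-isolated x)))
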